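{- Let $2\leq r\leq n$ be integers and let $(s_2,\ldots,s_r)$ be positive integers. Then there exists an integer $N$ (depending on $n$ and $s_2,\ldots,s_r$) such that $\overline{H}_n(s_1,s_2,\ldots,s_r)$ is not an integer for every positive integer $s_1>N$.
   Context: $\overline{H}_n(s_1,\ldots,s_r)=\sum_{0\leq k_1<\cdots<k_r\leq n-1}\prod_{j=1}^{r}(2k_j+1)^{ -s_j}$. -}

module Defs where

open import Data.Nat using (ℕ; zero; suc; _+_; _*_; _^_)
open import Data.Nat.Properties using (m^n≢0)
open import Data.List using (List; []; _∷_)
open import Data.Integer using (ℤ; +_)
open import Data.Rational as ℚ using (ℚ; _/_)
open import Data.Product using (∃-syntax)
open import Relation.Binary.PropositionalEquality using (_≡_)

oddInvPow : ℕ → ℕ → ℚ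
oddInvPow k s = (+ 1) / ((suc (2 * k)) ^ s)
  where instance _ = m^n≢0 (suc (2 * k)) s

-- HfromCount c lo ss sums over lo ≤ k₁ < ⋯ < kᵣ ≤ lo + c - 1.
HfromCount : ℕ → ℕ → List ℕ → ℚ
HfromCount c       lo []       = ℚ.1ℚ
HfromCount zero    lo (s ∷ ss) = ℚ.0ℚ
HfromCount (suc c) lo (s ∷ ss) =
  -- either k₁ = lo, or k₁ > lo
  oddInvPow lo s ℚ.* HfromCount c (suc lo) ss ℚ.+ HfromCount c (suc lo) (s ∷ ss)

Hbar : ℕ → List ℕ → ℚ
Hbar n ss = HfromCount n 0 ss

IsInteger : ℚ → Set
IsInteger q = ∃[ z ] (q ≡ z / 1)

module Submission where

-- Split off the k₁ = 0 terms: H̄ₙ(s₁,s₂,…,sᵣ) = C + E, where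
-- C = Σ_{1 ≤ k₂ < ⋯ < kᵣ ≤ n-1} ∏_{j≥2} (2kⱼ+1)^{-sⱼ} does not depend on s₁ and E collects the
-- terms with k₁ ≥ 1.  If r < n then 0 < E ≤ 2^{n-1} 3^{-s₁}, so for large s₁ the sum C + E lies
-- strictly between C and C + 1/d, where d is the denominator of C; no integer lies there.
-- If r = n then E = 0 and C = ∏_{k=1}^{n-1} (2k+1)^{-s_{k+1}} lies in (0,1), as s₂ ≥ 1.

open import Defs
open import Data.Nat as ℕ using (ℕ; zero; suc; _≤_; _<_; _+_; _^_; s≤s; z≤n; NonZero)
import Data.Nat.Properties as ℕ
open import Data.Integer as ℤ using (ℤ; +_)
import Data.Integer.Properties as ℤ
open import Data.Integer.Tactic.RingSolver using (solve-∀)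
open import Data.Rational as ℚ using (ℚ; mkℚ; _/_; toℚᵘ; 0ℚ; 1ℚ; ↧ₙ_)
import Data.Rational.Properties as ℚ
open import Data.Rational.Unnormalised as ℚᵘ using (mkℚᵘ; *≤*; *<*; *≡*)
import Data.Rational.Unnormalised.Properties as ℚᵘ
open import Data.List using (List; []; _∷_; length)
open import Data.List.Relation.Unary.All using (All; _∷_)
open import Data.Product using (∃-syntax; _,_)
open import Data.Sum using (inj₁; inj₂)
open import Function using (_∘_)
open import Relation.Nullary using (¬_)
open import Relation.Binary.PropositionalEquality

n<m^n : ∀ {m} .{{_ : NonZero m}} → 1 < m → ∀ n → n < m ^ n
n<m^n 1<m zero    = s≤s z≤n
n<m^n {m} 1<m (suc n) = ℕ.≤-trans (ℕ.+-mono-≤ (ℕ.m^n>0 m n) (ℕ.m≤n⇒m≤n+o 0 (n<m^n 1<m n)))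
  (ℕ.*-monoˡ-≤ (m ^ n) 1<m)

toℚᵘ-/ : ∀ i n .{{_ : NonZero n}} → toℚᵘ (i / n) ℚᵘ.≃ mkℚᵘ i (ℕ.pred n)
toℚᵘ-/ i (suc n) = ℚ.toℚᵘ-fromℚᵘ (mkℚᵘ i n)

0≤*0≤ : ∀ {p q} → 0ℚ ℚ.≤ p → 0ℚ ℚ.≤ q → 0ℚ ℚ.≤ p ℚ.* q
0≤*0≤ {p} {q} 0≤p 0≤q = ℚ.nonNegative⁻¹ _ {{ℚ.nonNeg*nonNeg⇒nonNeg p {{ℚ.nonNegative 0≤p}} q {{ℚ.nonNegative 0≤q}}}}

0<*0< : ∀ {p q} → 0ℚ ℚ.< p → 0ℚ ℚ.< q → 0ℚ ℚ.< p ℚ.* q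
0<*0< {p} {q} 0<p 0<q = ℚ.positive⁻¹ _ {{ℚ.pos*pos⇒pos p {{ℚ.positive 0<p}} q {{ℚ.positive 0<q}}}}

*-≤-contract : ∀ {p q} → 0ℚ ℚ.≤ q → p ℚ.≤ 1ℚ → p ℚ.* q ℚ.≤ q
*-≤-contract {p} {q} 0≤q p≤1 = subst (p ℚ.* q ℚ.≤_) (ℚ.*-identityˡ q) (ℚ.*-monoʳ-≤-nonNeg q {{ℚ.nonNegative 0≤q}} p≤1)

1/-antimono-≤ : ∀ a b .{{_ : NonZero a}} .{{_ : NonZero b}} → b ≤ a → (+ 1) / a ℚ.≤ (+ 1) / b
1/-antimono-≤ (suc a) (suc b) b≤a = ℚ.toℚᵘ-cancel-≤
  (ℚᵘ.≤-respʳ-≃ (ℚᵘ.≃-sym (toℚᵘ-/ (+ 1) (suc b))) (ℚᵘ.≤-respˡ-≃ (ℚᵘ.≃-sym (toℚᵘ-/ (+ 1) (suc a)))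
    (*≤* (subst₂ ℤ._≤_ (sym (ℤ.*-identityˡ _)) (sym (ℤ.*-identityˡ _)) (ℤ.+≤+ b≤a)))))

1/-<1 : ∀ a .{{_ : NonZero a}} → 1 < a → (+ 1) / a ℚ.< 1ℚ
1/-<1 (suc a) 1<a = ℚ.toℚᵘ-cancel-< (ℚᵘ.<-respˡ-≃ (ℚᵘ.≃-sym (toℚᵘ-/ (+ 1) (suc a)))
  (*<* (subst₂ ℤ._<_ refl (sym (ℤ.*-identityˡ _)) (ℤ.+<+ 1<a))))

oddPow≢0 : ∀ k s → NonZero (suc (2 ℕ.* k) ^ s)
oddPow≢0 k s = ℕ.m^n≢0 (suc (2 ℕ.* k)) s

oddInvPow-pos : ∀ k s → 0ℚ ℚ.< oddInvPow k s
oddInvPow-pos k s = ℚ.positive⁻¹ _ {{ℚ.normalize-pos 1 (suc (2 ℕ.* k) ^ s) {{oddPow≢0 k s}}}}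

oddInvPow-nonNeg : ∀ k s → 0ℚ ℚ.≤ oddInvPow k s
oddInvPow-nonNeg k s = ℚ.<⇒≤ (oddInvPow-pos k s)

oddInvPow-≤1 : ∀ k s → oddInvPow k s ℚ.≤ 1ℚ
oddInvPow-≤1 k s = 1/-antimono-≤ (suc (2 ℕ.* k) ^ s) 1 {{oddPow≢0 k s}} (ℕ.m^n>0 (suc (2 ℕ.* k)) s)

oddInvPow-<1 : ∀ {k s} → 1 ≤ k → 1 ≤ s → oddInvPow k s ℚ.< 1ℚ
oddInvPow-<1 {k} {s} 1≤k 1≤s =
  1/-<1 (suc (2 ℕ.* k) ^ s) {{oddPow≢0 k s}} (ℕ.≤-<-trans 1≤s (n<m^n (s≤s (ℕ.≤-trans 1≤k (ℕ.m≤m+n k _))) s))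

oddInvPow-antitone : ∀ k s → oddInvPow (suc k) s ℚ.≤ oddInvPow k s
oddInvPow-antitone k s = 1/-antimono-≤ (suc (2 ℕ.* suc k) ^ s) (suc (2 ℕ.* k) ^ s)
  {{oddPow≢0 (suc k) s}} {{oddPow≢0 k s}}
  (ℕ.^-monoˡ-≤ s (s≤s (ℕ.*-monoʳ-≤ 2 (ℕ.n≤1+n k))))

oddInvPow-zero : ∀ s → oddInvPow 0 s ≡ 1ℚ
oddInvPow-zero s = ℚ./-cong {p₁ = + 1} {{oddPow≢0 0 s}} refl (ℕ.^-zeroˡ s)

-- Defined by doubling to follow the two-branch recursion of HfromCount.
twoPow : ℕ → ℚ
twoPow zero    = 1ℚ
twoPow (suc c) = twoPow c ℚ.+ twoPow c

twoPow-nonNeg : ∀ c → 0ℚ ℚ.≤ twoPow c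
twoPow-nonNeg zero    = ℚ.nonNegative⁻¹ 1ℚ
twoPow-nonNeg (suc c) = ℚ.+-mono-≤ (twoPow-nonNeg c) (twoPow-nonNeg c)

1≤twoPow : ∀ c → 1ℚ ℚ.≤ twoPow c
1≤twoPow zero    = ℚ.≤-refl
1≤twoPow (suc c) = subst (ℚ._≤ twoPow (suc c)) (ℚ.+-identityʳ 1ℚ) (ℚ.+-mono-≤ (1≤twoPow c) (twoPow-nonNeg c))

toℚᵘ-twoPow : ∀ c → toℚᵘ (twoPow c) ℚᵘ.≃ mkℚᵘ (+ 2 ^ c) 0
toℚᵘ-twoPow zero    = ℚᵘ.≃-refl
toℚᵘ-twoPow (suc c) = ℚᵘ.≃-trans (ℚ.toℚᵘ-homo-+ (twoPow c) (twoPow c))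
  (ℚᵘ.≃-trans (ℚᵘ.+-cong (toℚᵘ-twoPow c) (toℚᵘ-twoPow c)) (*≡* (double (2 ^ c))))
  where
  double : ∀ x → (+ x ℤ.* + 1 ℤ.+ + x ℤ.* + 1) ℤ.* + 1 ≡ + (x + (x + 0)) ℤ.* + 1
  double x = trans (ring (+ x)) (cong (ℤ._* + 1) (sym (trans (ℤ.pos-+ x (x + 0)) (cong (ℤ._+_ (+ x)) (ℤ.pos-+ x 0)))))
    where
    ring : ∀ a → (a ℤ.* + 1 ℤ.+ a ℤ.* + 1) ℤ.* + 1 ≡ (a ℤ.+ (a ℤ.+ + 0)) ℤ.* + 1
    ring = solve-∀

HfromCount-nonNeg : ∀ c lo ss → 0ℚ ℚ.≤ HfromCount c lo ss
HfromCount-nonNeg c       lo []       = ℚ.nonNegative⁻¹ 1ℚ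
HfromCount-nonNeg zero    lo (s ∷ ss) = ℚ.≤-refl
HfromCount-nonNeg (suc c) lo (s ∷ ss) = ℚ.+-mono-≤
  (0≤*0≤ (oddInvPow-nonNeg lo s) (HfromCount-nonNeg c (suc lo) ss)) (HfromCount-nonNeg c (suc lo) (s ∷ ss))

HfromCount-pos : ∀ c lo ss → length ss ≤ c → 0ℚ ℚ.< HfromCount c lo ss
HfromCount-pos c       lo []       _         = ℚ.positive⁻¹ 1ℚ
HfromCount-pos (suc c) lo (s ∷ ss) (s≤s len≤c) = ℚ.+-mono-<-≤
  (0<*0< (oddInvPow-pos lo s) (HfromCount-pos c (suc lo) ss len≤c)) (HfromCount-nonNeg c (suc lo) (s ∷ ss))

HfromCount-≡0 : ∀ c lo ss → c < length ss → HfromCount c lo ss ≡ 0ℚ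
HfromCount-≡0 zero    lo (s ∷ ss) _          = refl
HfromCount-≡0 (suc c) lo (s ∷ ss) (s≤s c<len)
  rewrite HfromCount-≡0 c (suc lo) ss c<len | HfromCount-≡0 c (suc lo) (s ∷ ss) (ℕ.m<n⇒m<1+n c<len)
  = trans (ℚ.+-identityʳ _) (ℚ.*-zeroʳ (oddInvPow lo s))

HfromCount-≤-twoPow : ∀ c lo ss → HfromCount c lo ss ℚ.≤ twoPow c
HfromCount-≤-twoPow c       lo []       = 1≤twoPow c
HfromCount-≤-twoPow zero    lo (s ∷ ss) = ℚ.nonNegative⁻¹ 1ℚ
HfromCount-≤-twoPow (suc c) lo (s ∷ ss) = ℚ.+-mono-≤
  (ℚ.≤-trans (*-≤-contract (HfromCount-nonNeg c (suc lo) ss) (oddInvPow-≤1 lo s)) (HfromCount-≤-twoPow c (suc lo) ss))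
  (HfromCount-≤-twoPow c (suc lo) (s ∷ ss))

HfromCount-∷-≤ : ∀ c lo s ss → HfromCount c lo (s ∷ ss) ℚ.≤ oddInvPow lo s ℚ.* twoPow c
HfromCount-∷-≤ zero    lo s ss = 0≤*0≤ (oddInvPow-nonNeg lo s) (ℚ.nonNegative⁻¹ 1ℚ)
HfromCount-∷-≤ (suc c) lo s ss = begin
  a ℚ.* HfromCount c (suc lo) ss ℚ.+ HfromCount c (suc lo) (s ∷ ss)
    ≤⟨ ℚ.+-mono-≤ (ℚ.*-monoˡ-≤-nonNeg a {{ℚ.nonNegative (oddInvPow-nonNeg lo s)}} (HfromCount-≤-twoPow c (suc lo) ss))
                  (HfromCount-∷-≤ c (suc lo) s ss) ⟩
  a ℚ.* twoPow c ℚ.+ oddInvPow (suc lo) s ℚ.* twoPow c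
    ≤⟨ ℚ.+-monoʳ-≤ (a ℚ.* twoPow c) (ℚ.*-monoʳ-≤-nonNeg (twoPow c) {{ℚ.nonNegative (twoPow-nonNeg c)}} (oddInvPow-antitone lo s)) ⟩
  a ℚ.* twoPow c ℚ.+ a ℚ.* twoPow c
    ≡⟨ ℚ.*-distribˡ-+ a (twoPow c) (twoPow c) ⟨
  a ℚ.* twoPow (suc c) ∎
  where
  open ℚ.≤-Reasoning
  a : ℚ
  a = oddInvPow lo s

HfromCount-full-∷ : ∀ c lo s ss → length ss ≡ c →
  HfromCount (suc c) lo (s ∷ ss) ≡ oddInvPow lo s ℚ.* HfromCount c (suc lo) ss
HfromCount-full-∷ c lo s ss refl =
  trans (cong (oddInvPow lo s ℚ.* HfromCount c (suc lo) ss ℚ.+_) (HfromCount-≡0 c (suc lo) (s ∷ ss) ℕ.≤-refl))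
        (ℚ.+-identityʳ _)

HfromCount-full-≤1 : ∀ c lo ss → length ss ≡ c → HfromCount c lo ss ℚ.≤ 1ℚ
HfromCount-full-≤1 c       lo []       _   = ℚ.≤-refl
HfromCount-full-≤1 (suc c) lo (s ∷ ss) len rewrite HfromCount-full-∷ c lo s ss (ℕ.suc-injective len) =
  ℚ.≤-trans (*-≤-contract (HfromCount-nonNeg c (suc lo) ss) (oddInvPow-≤1 lo s))
            (HfromCount-full-≤1 c (suc lo) ss (ℕ.suc-injective len))

HfromCount-full-<1 : ∀ c lo s ss → 1 ≤ lo → 1 ≤ s → length ss ≡ c → HfromCount (suc c) lo (s ∷ ss) ℚ.< 1ℚ
HfromCount-full-<1 c lo s ss 1≤lo 1≤s len rewrite HfromCount-full-∷ c lo s ss len =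
  ℚ.≤-<-trans (ℚ.≤-trans (ℚ.≤-reflexive (ℚ.*-comm (oddInvPow lo s) _))
                           (*-≤-contract (oddInvPow-nonNeg lo s) (HfromCount-full-≤1 c (suc lo) ss len)))
              (oddInvPow-<1 1≤lo 1≤s)

Hbar-suc-∷ : ∀ m s ss → Hbar (suc m) (s ∷ ss) ≡ HfromCount m 1 ss ℚ.+ HfromCount m 1 (s ∷ ss)
Hbar-suc-∷ m s ss = cong (ℚ._+ HfromCount m 1 (s ∷ ss))
  (trans (cong (ℚ._* HfromCount m 1 ss) (oddInvPow-zero s)) (ℚ.*-identityˡ (HfromCount m 1 ss)))

-- With q = p/d, the integer inequality p < z·d sharpens to p + 1 ≤ z·d.
<-integer⇒+1/↧ₙ≤ : ∀ q z → q ℚ.< z / 1 → q ℚ.+ (+ 1) / ↧ₙ q ℚ.≤ z / 1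
<-integer⇒+1/↧ₙ≤ q@(mkℚ p d-1 _) z q<z with ℚᵘ.<-respʳ-≃ (toℚᵘ-/ z 1) (ℚ.toℚᵘ-mono-< q<z)
... | *<* p<z*d = ℚ.toℚᵘ-cancel-≤
  (ℚᵘ.≤-respˡ-≃ (ℚᵘ.≃-sym (ℚᵘ.≃-trans (ℚ.toℚᵘ-homo-+ q ((+ 1) / d)) (ℚᵘ.+-congʳ (mkℚᵘ p d-1) (toℚᵘ-/ (+ 1) d))))
  (ℚᵘ.≤-respʳ-≃ (ℚᵘ.≃-sym (toℚᵘ-/ z 1)) (*≤* p+1≤z*d)))
  where
  d : ℕ
  d = suc d-1
  ring : ∀ (p D : ℤ) → (+ 1 ℤ.+ p ℤ.* + 1) ℤ.* D ≡ (p ℤ.* D ℤ.+ + 1 ℤ.* D) ℤ.* + 1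
  ring = solve-∀
  p+1≤z*d : (p ℤ.* + d ℤ.+ + 1 ℤ.* + d) ℤ.* + 1 ℤ.≤ z ℤ.* + (d ℕ.* d)
  p+1≤z*d = subst₂ ℤ._≤_ (ring p (+ d)) (trans (ℤ.*-assoc z (+ d) (+ d)) (cong (z ℤ.*_) (sym (ℤ.pos-* d d))))
    (ℤ.*-monoʳ-≤-nonNeg (+ d) (ℤ.i<j⇒suc[i]≤j p<z*d))

¬IsInteger-+ : ∀ q e → 0ℚ ℚ.< e → e ℚ.< (+ 1) / ↧ₙ q → ¬ IsInteger (q ℚ.+ e)
¬IsInteger-+ q e 0<e e<1/d (z , q+e≡z) = ℚ.<-irrefl refl (ℚ.≤-<-trans q+1/d≤q+e (ℚ.+-monoʳ-< q e<1/d))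
  where
  q<z : q ℚ.< z / 1
  q<z = subst (ℚ._< z / 1) (ℚ.+-identityʳ q) (subst (q ℚ.+ 0ℚ ℚ.<_) q+e≡z (ℚ.+-monoʳ-< q 0<e))
  q+1/d≤q+e : q ℚ.+ (+ 1) / ↧ₙ q ℚ.≤ q ℚ.+ e
  q+1/d≤q+e = subst (q ℚ.+ (+ 1) / ↧ₙ q ℚ.≤_) (sym q+e≡z) (<-integer⇒+1/↧ₙ≤ q z q<z)

¬IsInteger-between-0-1 : ∀ q → 0ℚ ℚ.< q → q ℚ.< 1ℚ → ¬ IsInteger q
¬IsInteger-between-0-1 q 0<q q<1 (z , refl)
  with ℚᵘ.<-respʳ-≃ (toℚᵘ-/ z 1) (ℚ.toℚᵘ-mono-< 0<q) | ℚᵘ.<-respˡ-≃ (toℚᵘ-/ z 1) (ℚ.toℚᵘ-mono-< q<1)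
... | *<* 0<z | *<* z<1 = ℤ.<-irrefl refl (ℤ.≤-<-trans (ℤ.i<j⇒suc[i]≤j (subst (+ 0 ℤ.<_) (ℤ.*-identityʳ z) 0<z))
                                                      (subst (ℤ._< + 1) (ℤ.*-identityʳ z) z<1))

1/[1+2^M*d]*twoPow<1/d : ∀ M d .{{_ : NonZero d}} → (+ 1) / suc (2 ^ M ℕ.* d) ℚ.* twoPow M ℚ.< (+ 1) / d
1/[1+2^M*d]*twoPow<1/d M (suc d-1) = ℚ.toℚᵘ-cancel-<
  (ℚᵘ.<-respˡ-≃ (ℚᵘ.≃-sym (ℚᵘ.≃-trans (ℚ.toℚᵘ-homo-* ((+ 1) / suc t) (twoPow M))
                                     (ℚᵘ.*-cong (toℚᵘ-/ (+ 1) (suc t)) (toℚᵘ-twoPow M))))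
  (ℚᵘ.<-respʳ-≃ (ℚᵘ.≃-sym (toℚᵘ-/ (+ 1) d)) (*<* 2^M*d<1+t)))
  where
  d t : ℕ
  d = suc d-1
  t = 2 ^ M ℕ.* d
  2^M*d<1+t : (+ 1 ℤ.* + 2 ^ M) ℤ.* + d ℤ.< + 1 ℤ.* + suc (t ℕ.* 1)
  2^M*d<1+t = subst₂ ℤ._<_
    (trans (ℤ.pos-* (2 ^ M) d) (cong (ℤ._* + d) (sym (ℤ.*-identityˡ (+ 2 ^ M)))))
    (trans (cong (λ u → + suc u) (sym (ℕ.*-identityʳ t))) (sym (ℤ.*-identityˡ _)))
    (ℤ.+<+ (ℕ.n<1+n t))

¬IsInteger-Hbar-r<n : ∀ m ss → length ss < m →
  ∃[ N ] ((s₁ : ℕ) → N < s₁ → ¬ IsInteger (Hbar (suc m) (s₁ ∷ ss)))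
¬IsInteger-Hbar-r<n m ss len<m = N , notInteger
  where
  C : ℚ
  C = HfromCount m 1 ss
  N : ℕ
  N = 2 ^ m ℕ.* ↧ₙ C

  E<1/↧C : ∀ s₁ → N < s₁ → HfromCount m 1 (s₁ ∷ ss) ℚ.< (+ 1) / ↧ₙ C
  E<1/↧C s₁ N<s₁ = begin-strict
    HfromCount m 1 (s₁ ∷ ss)       ≤⟨ HfromCount-∷-≤ m 1 s₁ ss ⟩
    oddInvPow 1 s₁ ℚ.* twoPow m    ≤⟨ ℚ.*-monoʳ-≤-nonNeg (twoPow m) {{ℚ.nonNegative (twoPow-nonNeg m)}}
                                         (1/-antimono-≤ (3 ^ s₁) (suc N) {{oddPow≢0 1 s₁}} N<3^s₁) ⟩
    (+ 1) / suc N ℚ.* twoPow m     <⟨ 1/[1+2^M*d]*twoPow<1/d m (↧ₙ C) ⟩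
    (+ 1) / ↧ₙ C                   ∎
    where
    open ℚ.≤-Reasoning
    N<3^s₁ : N < 3 ^ s₁
    N<3^s₁ = ℕ.<-trans N<s₁ (n<m^n (s≤s (s≤s z≤n)) s₁)

  notInteger : (s₁ : ℕ) → N < s₁ → ¬ IsInteger (Hbar (suc m) (s₁ ∷ ss))
  notInteger s₁ N<s₁ = subst (¬_ ∘ IsInteger) (sym (Hbar-suc-∷ m s₁ ss))
    (¬IsInteger-+ C (HfromCount m 1 (s₁ ∷ ss)) (HfromCount-pos m 1 (s₁ ∷ ss) len<m) (E<1/↧C s₁ N<s₁))

¬IsInteger-Hbar-r≡n : ∀ s₁ s₂ ss → 1 ≤ s₂ → ¬ IsInteger (Hbar (suc (length (s₂ ∷ ss))) (s₁ ∷ s₂ ∷ ss))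
¬IsInteger-Hbar-r≡n s₁ s₂ ss 1≤s₂ = subst (¬_ ∘ IsInteger) (sym Hbar≡C)
  (¬IsInteger-between-0-1 C (HfromCount-pos m 1 (s₂ ∷ ss) ℕ.≤-refl) (HfromCount-full-<1 _ 1 s₂ ss ℕ.≤-refl 1≤s₂ refl))
  where
  open ≡-Reasoning
  m : ℕ
  m = length (s₂ ∷ ss)
  C : ℚ
  C = HfromCount m 1 (s₂ ∷ ss)
  Hbar≡C : Hbar (suc m) (s₁ ∷ s₂ ∷ ss) ≡ C
  Hbar≡C = begin
    Hbar (suc m) (s₁ ∷ s₂ ∷ ss)               ≡⟨ Hbar-suc-∷ m s₁ (s₂ ∷ ss) ⟩
    C ℚ.+ HfromCount m 1 (s₁ ∷ s₂ ∷ ss)       ≡⟨ cong (C ℚ.+_) (HfromCount-≡0 m 1 (s₁ ∷ s₂ ∷ ss) ℕ.≤-refl) ⟩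
    C ℚ.+ 0ℚ                                  ≡⟨ ℚ.+-identityʳ C ⟩
    C                                         ∎

lemma2p8 : (n r : ℕ) → 2 ≤ r → r ≤ n → (ss : List ℕ) → 1 + length ss ≡ r → All (0 <_) ss →
    ∃[ N ] ((s₁ : ℕ) → 0 < s₁ → N < s₁ → ¬ IsInteger (Hbar n (s₁ ∷ ss)))
lemma2p8 _       _ (s≤s ()) _   []       refl _
lemma2p8 zero    _ _        ()  (_ ∷ _)  refl _
lemma2p8 (suc m) _ _        r≤n (s₂ ∷ ss) refl (1≤s₂ ∷ _) with ℕ.m≤n⇒m<n∨m≡n (ℕ.s≤s⁻¹ r≤n)
... | inj₁ short = let N , notInteger = ¬IsInteger-Hbar-r<n m (s₂ ∷ ss) short in N , λ s₁ _ → notInteger s₁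
... | inj₂ refl  = 0 , λ s₁ _ _ → ¬IsInteger-Hbar-r≡n s₁ s₂ ss 1≤s₂
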